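{- Let $\mathbb{F}$ be a field and $n\ge 3$. If $\mathcal{C}$ is a linear or dually linear coclique of $\Gamma_1$, then for every anti-flag $A\notin\mathcal{C}$ one of the following holds: (1) $A^{\sim_1}\cap\mathcal{C}$ is empty; (2) $A^{\sim_1}\cap\mathcal{C}$ is a singleton; (3) $A^{\sim_1}\cap\mathcal{C}$ contains all anti-flags of $\mathcal{C}$ except one; (4) $\mathcal{C}\subset A^{\sim_1}$.
   Context: An anti-flag is a pair $(p,H)$ of a point $p$ and a hyperplane $H$ of $\mathrm{PG}(n-1,\mathbb{F})$ with $p\notin H$. For distinct anti-flags, $(p_1,H_1)\sim_1(p_2,H_2)$ iff $p_j\in H_{3-j}$ and $p_{3-j}\notin H_j$ for some $j\in\{1,2\}$. $\Gamma_1$ is the graph on anti-flags with adjacency $\sim_1$; a coclique is a set of pairwise non-adjacent vertices. $A^{\sim_1}$ is the set of anti-flags $\sim_1$-related to $A$. A coclique is linear if all its anti-flags have a common hyperplane and their points all lie on one line; it is dually linear if all its anti-flags have a common point and their hyperplanes all contain a common $(n-3)$-dimensional projective subspace (i.e. lie on a line of the dual projective space). -}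

module Defs where

open import Level using (Level; _⊔_; suc)
open import Data.Nat using (ℕ)
open import Data.Fin using (Fin)
open import Data.Product using (Σ; ∃; _×_; _,_)
open import Data.Sum using (_⊎_)
open import Relation.Nullary using (¬_)
open import Algebra.Bundles using (CommutativeRing)
import Data.Vec.Functional as VF

record Field (c ℓ : Level) : Set (suc (c ⊔ ℓ)) where
  field
    commutativeRing : CommutativeRing c ℓ
  open CommutativeRing commutativeRing public
  field
    0≉1     : ¬ (0# ≈ 1#)
    inverse : ∀ x → ¬ (x ≈ 0#) → Σ Carrier λ y → x * y ≈ 1#

module Projective {c ℓ : Level} (F : Field c ℓ) (n : ℕ) where
  open Field F

  -- coordinate vectors of F^n (also used for linear functionals = dual vectors)
  Vec : Set c
  Vec = Fin n → Carrier

  IsZero : Vec → Set ℓ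
  IsZero v = ∀ i → v i ≈ 0#

  ⟨_,_⟩ : Vec → Vec → Carrier
  ⟨ φ , v ⟩ = VF.foldr _+_ 0# (λ i → φ i * v i)

  -- two vectors represent the same projective point (resp. hyperplane)
  Proportional : Vec → Vec → Set (c ⊔ ℓ)
  Proportional v w = Σ Carrier λ a → ¬ (a ≈ 0#) × (∀ i → w i ≈ a * v i)

  -- v lies on the projective line spanned by the independent vectors u, w
  -- (used for points on a line of PG(n-1,F), and dually for hyperplanes
  --  lying on a line of the dual space, i.e. containing a common
  --  (n-3)-dimensional subspace)
  InSpan : Vec → Vec → Vec → Set (c ⊔ ℓ)
  InSpan u w v = Σ Carrier λ s → Σ Carrier λ t → ∀ i → v i ≈ s * u i + t * w i

  IsLine : Vec → Vec → Set (c ⊔ ℓ)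
  IsLine u w = ¬ IsZero u × ¬ IsZero w × ¬ Proportional u w

  record AntiFlag : Set (c ⊔ ℓ) where
    constructor antiFlag
    field
      pt     : Vec
      hyp    : Vec
      pt≠0   : ¬ IsZero pt
      hyp≠0  : ¬ IsZero hyp
      pt∉hyp : ¬ (⟨ hyp , pt ⟩ ≈ 0#)
  open AntiFlag public

  _∈ₕ_ : Vec → Vec → Set ℓ
  p ∈ₕ H = ⟨ H , p ⟩ ≈ 0#

  _≋_ : AntiFlag → AntiFlag → Set (c ⊔ ℓ)
  a ≋ b = Proportional (pt a) (pt b) × Proportional (hyp a) (hyp b)

  _∼₁_ : AntiFlag → AntiFlag → Set (c ⊔ ℓ)
  a ∼₁ b = ¬ (a ≋ b) ×
    ((pt a ∈ₕ hyp b × ¬ (pt b ∈ₕ hyp a)) ⊎ (pt b ∈ₕ hyp a × ¬ (pt a ∈ₕ hyp b)))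

  -- sets of anti-flags: predicates invariant under ≋
  WellDefined : ∀ {ℓ'} → (AntiFlag → Set ℓ') → Set (c ⊔ ℓ ⊔ ℓ')
  WellDefined C = ∀ a b → a ≋ b → C a → C b

  Coclique : ∀ {ℓ'} → (AntiFlag → Set ℓ') → Set (c ⊔ ℓ ⊔ ℓ')
  Coclique C = ∀ a b → C a → C b → ¬ (a ∼₁ b)

  Linear : ∀ {ℓ'} → (AntiFlag → Set ℓ') → Set (c ⊔ ℓ ⊔ ℓ')
  Linear C = Σ Vec λ H₀ → ¬ IsZero H₀ × Σ Vec λ u → Σ Vec λ w → IsLine u w ×
    (∀ a → C a → Proportional H₀ (hyp a) × InSpan u w (pt a))

  DuallyLinear : ∀ {ℓ'} → (AntiFlag → Set ℓ') → Set (c ⊔ ℓ ⊔ ℓ')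
  DuallyLinear C = Σ Vec λ p₀ → ¬ IsZero p₀ × Σ Vec λ φ → Σ Vec λ ψ → IsLine φ ψ ×
    (∀ a → C a → Proportional p₀ (pt a) × InSpan φ ψ (hyp a))

  Empty∩ : ∀ {ℓ'} → AntiFlag → (AntiFlag → Set ℓ') → Set (c ⊔ ℓ ⊔ ℓ')
  Empty∩ A C = ∀ b → C b → ¬ (A ∼₁ b)

  Singleton∩ : ∀ {ℓ'} → AntiFlag → (AntiFlag → Set ℓ') → Set (c ⊔ ℓ ⊔ ℓ')
  Singleton∩ A C = Σ AntiFlag λ b → (C b × A ∼₁ b) × (∀ b' → C b' → A ∼₁ b' → b' ≋ b)

  AllButOne∩ : ∀ {ℓ'} → AntiFlag → (AntiFlag → Set ℓ') → Set (c ⊔ ℓ ⊔ ℓ')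
  AllButOne∩ A C = Σ AntiFlag λ b → (C b × ¬ (A ∼₁ b)) × (∀ b' → C b' → ¬ (b' ≋ b) → A ∼₁ b')

  All∩ : ∀ {ℓ'} → AntiFlag → (AntiFlag → Set ℓ') → Set (c ⊔ ℓ ⊔ ℓ')
  All∩ A C = ∀ b → C b → A ∼₁ b

{-# OPTIONS --safe #-}
module Submission where

-- For b ∈ C, A ∼₁ b says that exactly one of p_A ∈ H_b and p_b ∈ H_A holds
-- (A ≋ b is impossible as A ∉ C). In the linear case every H_b is H₀, so the
-- first condition does not depend on b, while the points p_b lie on a line,
-- which is either contained in H_A or meets it in at most one point. So
-- A^∼₁ ∩ C is S = {b ∈ C : p_b ∈ H_A} or its complement in C, where S is all
-- of C or has at most one element; the four combinations are the four
-- alternatives. The dually linear case is the same argument in the dual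
-- space. Excluded middle is used for the case distinctions, whence the double
-- negation.

open import Defs
open import Level using (Level; _⊔_)
open import Data.Nat using (ℕ; _≤_)
open import Data.Fin using (Fin)
open import Data.Product as Product using (Σ; ∃; _×_; _,_; proj₁; proj₂)
open import Data.Sum as Sum using (_⊎_; inj₁; inj₂; swap)
open import Function.Base using (_∘_)
open import Function.Bundles using (_⇔_; mk⇔; Equivalence)
open import Function.Construct.Composition using (_⇔-∘_)
open import Function.Construct.Symmetry using (⇔-sym)
open import Data.Empty using (⊥-elim)
open import Relation.Nullary using (¬_; Dec; yes; no)
open import Relation.Nullary.Negation using (¬¬-map)
open import Relation.Nullary.Decidable using (¬¬-excluded-middle)

open Equivalence using (to; from)

private
  variable
    a b : Level
    P P′ Q : Set a

Xor : Set a → Set b → Set (a ⊔ b)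
Xor P Q = (P × ¬ Q) ⊎ (Q × ¬ P)

Xor-comm : Xor P Q ⇔ Xor Q P
Xor-comm = mk⇔ swap swap

Xor-congˡ : P ⇔ P′ → Xor P Q ⇔ Xor P′ Q
Xor-congˡ P⇔P′ = mk⇔
  (Sum.map (Product.map₁ (to P⇔P′)) (Product.map₂ (λ ¬p → ¬p ∘ from P⇔P′)))
  (Sum.map (Product.map₁ (from P⇔P′)) (Product.map₂ (λ ¬p′ → ¬p′ ∘ to P⇔P′)))

Xor-trueˡ : P → Xor P Q → ¬ Q
Xor-trueˡ _ (inj₁ (_ , ¬q)) = ¬q
Xor-trueˡ p (inj₂ (_ , ¬p)) = λ _ → ¬p p

Xor-falseˡ : ¬ P → Xor P Q → Q
Xor-falseˡ ¬p (inj₁ (p , _)) = ⊥-elim (¬p p)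
Xor-falseˡ ¬p (inj₂ (q , _)) = q

module FieldProperties {c ℓ} (F : Field c ℓ) where
  open Field F
  open import Algebra.Solver.Ring.NaturalCoefficients.Default commutativeSemiring
  open import Relation.Binary.Reasoning.Setoid setoid

  *-cancelˡ-≈ : ∀ {k x y} → ¬ k ≈ 0# → k * x ≈ k * y → x ≈ y
  *-cancelˡ-≈ {k} {x} {y} k≉0 kx≈ky with inverse k k≉0
  ... | k⁻¹ , kk⁻¹≈1 = begin
    x              ≈⟨ sym (*-identityˡ x) ⟩
    1# * x         ≈⟨ *-congʳ (sym kk⁻¹≈1) ⟩
    k * k⁻¹ * x    ≈⟨ swap-factors k k⁻¹ x ⟩
    k⁻¹ * (k * x)  ≈⟨ *-congˡ kx≈ky ⟩
    k⁻¹ * (k * y)  ≈⟨ swap-factors k k⁻¹ y ⟨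
    k * k⁻¹ * y    ≈⟨ *-congʳ kk⁻¹≈1 ⟩
    1# * y         ≈⟨ *-identityˡ y ⟩
    y              ∎
    where
    swap-factors : ∀ k k′ x → k * k′ * x ≈ k′ * (k * x)
    swap-factors = solve 3 (λ k k′ x → k :* k′ :* x := k′ :* (k :* x)) refl

  x*y≈0⇒y≈0 : ∀ {x y} → ¬ x ≈ 0# → x * y ≈ 0# → y ≈ 0#
  x*y≈0⇒y≈0 x≉0 xy≈0 = *-cancelˡ-≈ x≉0 (trans xy≈0 (sym (zeroʳ _)))

  x*y≉0 : ∀ {x y} → ¬ x ≈ 0# → ¬ y ≈ 0# → ¬ x * y ≈ 0#
  x*y≉0 x≉0 y≉0 = y≉0 ∘ x*y≈0⇒y≈0 x≉0

  inverse-≉0 : ∀ {x y} → x * y ≈ 1# → ¬ y ≈ 0#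
  inverse-≉0 {x} xy≈1 y≈0 = 0≉1 (begin
    0#      ≈⟨ zeroʳ x ⟨
    x * 0#  ≈⟨ *-congˡ y≈0 ⟨
    x * _   ≈⟨ xy≈1 ⟩
    1#      ∎)

  cross-multiplication : ∀ {x y s t s′ t′} → ¬ x ≈ 0# →
    s * x + t * y ≈ 0# → s′ * x + t′ * y ≈ 0# → s′ * t ≈ s * t′
  cross-multiplication {x} {y} {s} {t} {s′} {t′} x≉0 e e′ = *-cancelˡ-≈ x≉0 (begin
    x * (s′ * t)                           ≈⟨ x+y*0≈x _ t′ ⟨
    x * (s′ * t) + t′ * 0#                 ≈⟨ +-congˡ (*-congˡ e) ⟨
    x * (s′ * t) + t′ * (s * x + t * y)    ≈⟨ exchange x y s t s′ t′ ⟩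
    x * (s * t′) + t * (s′ * x + t′ * y)   ≈⟨ +-congˡ (*-congˡ e′) ⟩
    x * (s * t′) + t * 0#                  ≈⟨ x+y*0≈x _ t ⟩
    x * (s * t′)                           ∎)
    where
    x+y*0≈x : ∀ x y → x + y * 0# ≈ x
    x+y*0≈x x y = trans (+-congˡ (zeroʳ y)) (+-identityʳ x)
    -- x (s′t − st′) = t (s′x + t′y) − t′ (sx + ty), rearranged to avoid subtraction
    exchange : ∀ x y s t s′ t′ →
      x * (s′ * t) + t′ * (s * x + t * y) ≈ x * (s * t′) + t * (s′ * x + t′ * y)
    exchange = solve 6 (λ x y s t s′ t′ →
      x :* (s′ :* t) :+ t′ :* (s :* x :+ t :* y) := x :* (s :* t′) :+ t :* (s′ :* x :+ t′ :* y)) refl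

  coefficients-proportional : ∀ {s t s′ t′} → ¬ t ≈ 0# → s′ * t ≈ s * t′ →
    Σ Carrier λ k → s′ ≈ k * s × t′ ≈ k * t
  coefficients-proportional {s} {t} {s′} {t′} t≉0 s′t≈st′ with inverse t t≉0
  ... | t⁻¹ , tt⁻¹≈1 = t′ * t⁻¹ , s′≈ , t′≈
    where
    divide : ∀ {z} → z ≈ z * t * t⁻¹
    divide {z} = trans (sym (*-identityʳ z))
      (trans (*-congˡ (sym tt⁻¹≈1)) (sym (*-assoc z t t⁻¹)))
    s′≈ : s′ ≈ t′ * t⁻¹ * s
    s′≈ = begin
      s′                ≈⟨ divide ⟩
      s′ * t * t⁻¹      ≈⟨ *-congʳ s′t≈st′ ⟩
      s * t′ * t⁻¹      ≈⟨ solve 3 (λ s t′ t⁻¹ → s :* t′ :* t⁻¹ := t′ :* t⁻¹ :* s) refl s t′ t⁻¹ ⟩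
      t′ * t⁻¹ * s      ∎
    t′≈ : t′ ≈ t′ * t⁻¹ * t
    t′≈ = begin
      t′                ≈⟨ divide ⟩
      t′ * t * t⁻¹      ≈⟨ solve 3 (λ t′ t t⁻¹ → t′ :* t :* t⁻¹ := t′ :* t⁻¹ :* t) refl t′ t t⁻¹ ⟩
      t′ * t⁻¹ * t      ∎

module ProjectiveProperties {c ℓ} (F : Field c ℓ) (n : ℕ) where
  open Field F
  open FieldProperties F
  open Projective F n
  open import Algebra.Properties.Semiring.Sum semiring
    using (sum; sum-cong-≋; ∑-distrib-+; *-distribˡ-sum)
  open import Algebra.Solver.Ring.NaturalCoefficients.Default commutativeSemiring
  open import Relation.Binary.Reasoning.Setoid setoid

  IsLinear : (Vec → Carrier) → Set (c ⊔ ℓ)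
  IsLinear f = ∀ {u w v} s t → (∀ i → v i ≈ s * u i + t * w i) → f v ≈ s * f u + t * f w

  sum-linear : ∀ {m} {g g₁ g₂ : Fin m → Carrier} s t →
    (∀ i → g i ≈ s * g₁ i + t * g₂ i) → sum g ≈ s * sum g₁ + t * sum g₂
  sum-linear {g = g} {g₁} {g₂} s t g≈ = begin
    sum g                                        ≈⟨ sum-cong-≋ g≈ ⟩
    sum (λ i → s * g₁ i + t * g₂ i)              ≈⟨ ∑-distrib-+ (λ i → s * g₁ i) (λ i → t * g₂ i) ⟩
    sum (λ i → s * g₁ i) + sum (λ i → t * g₂ i)  ≈⟨ +-cong (*-distribˡ-sum s g₁) (*-distribˡ-sum t g₂) ⟨
    s * sum g₁ + t * sum g₂                      ∎

  ⟨⟩-linearʳ : ∀ φ → IsLinear ⟨ φ ,_⟩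
  ⟨⟩-linearʳ φ s t v≈ = sum-linear s t λ i → trans (*-congˡ (v≈ i)) (scale-distrib (φ i) s _ t _)
    where
    scale-distrib : ∀ x s u t w → x * (s * u + t * w) ≈ s * (x * u) + t * (x * w)
    scale-distrib = solve 5 (λ x s u t w → x :* (s :* u :+ t :* w) := s :* (x :* u) :+ t :* (x :* w)) refl

  ⟨⟩-linearˡ : ∀ p → IsLinear ⟨_, p ⟩
  ⟨⟩-linearˡ p s t φ≈ = sum-linear s t λ i → trans (*-congʳ (φ≈ i)) (scale-distrib (p i) s _ t _)
    where
    scale-distrib : ∀ x s u t w → (s * u + t * w) * x ≈ s * (u * x) + t * (w * x)
    scale-distrib = solve 5 (λ x s u t w → (s :* u :+ t :* w) :* x := s :* (u :* x) :+ t :* (w :* x)) refl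

  ∝-sym : ∀ {v w} → Proportional v w → Proportional w v
  ∝-sym {v} {w} (k , k≉0 , w≈kv) with inverse k k≉0
  ... | k⁻¹ , kk⁻¹≈1 = k⁻¹ , inverse-≉0 kk⁻¹≈1 , λ i → *-cancelˡ-≈ k≉0 (begin
    k * v i          ≈⟨ w≈kv i ⟨
    w i              ≈⟨ *-identityˡ (w i) ⟨
    1# * w i         ≈⟨ *-congʳ kk⁻¹≈1 ⟨
    k * k⁻¹ * w i    ≈⟨ *-assoc k k⁻¹ (w i) ⟩
    k * (k⁻¹ * w i)  ∎)

  ∝-trans : ∀ {u v w} → Proportional u v → Proportional v w → Proportional u w
  ∝-trans {u} (k , k≉0 , v≈ku) (l , l≉0 , w≈lv) =
    l * k , x*y≉0 l≉0 k≉0 , λ i → trans (w≈lv i) (trans (*-congˡ (v≈ku i)) (sym (*-assoc l k (u i))))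

  ≋-sym : ∀ {A B} → A ≋ B → B ≋ A
  ≋-sym = Product.map ∝-sym ∝-sym

  linear-scale : ∀ {f v v′ k} → IsLinear f → (∀ i → v′ i ≈ k * v i) → f v′ ≈ k * f v
  linear-scale {f} {v} {v′} {k} f-lin v′≈kv = begin
    f v′                ≈⟨ f-lin k 0# (λ i → trans (v′≈kv i) (sym (x+0*y≈x (k * v i) (v i)))) ⟩
    k * f v + 0# * f v  ≈⟨ x+0*y≈x (k * f v) (f v) ⟩
    k * f v             ∎
    where
    x+0*y≈x : ∀ x y → x + 0# * y ≈ x
    x+0*y≈x x y = trans (+-congˡ (zeroˡ y)) (+-identityʳ x)

  ∝-preserves-kernel : ∀ {f v v′} → IsLinear f → Proportional v v′ → f v ≈ 0# ⇔ f v′ ≈ 0#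
  ∝-preserves-kernel {f} {v} {v′} f-lin (k , k≉0 , v′≈kv) = mk⇔
    (λ fv≈0 → trans (linear-scale f-lin v′≈kv) (trans (*-congˡ fv≈0) (zeroʳ k)))
    (λ fv′≈0 → x*y≈0⇒y≈0 k≉0 (trans (sym (linear-scale f-lin v′≈kv)) fv′≈0))

  InSpan-swap : ∀ {u w v} → InSpan u w v → InSpan w u v
  InSpan-swap (s , t , v≈) = t , s , λ i → trans (v≈ i) (+-comm _ _)

  SpanInKernel : (Vec → Carrier) → Vec → Vec → Set (c ⊔ ℓ)
  SpanInKernel f u w = ∀ {v} → InSpan u w v → f v ≈ 0#

  SpanMeetsKernelOnce : (Vec → Carrier) → Vec → Vec → Set (c ⊔ ℓ)
  SpanMeetsKernelOnce f u w = ∀ {v v′} → InSpan u w v → InSpan u w v′ →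
    ¬ IsZero v → ¬ IsZero v′ → f v ≈ 0# → f v′ ≈ 0# → Proportional v v′

  span-⊆-kernel : ∀ {f u w} → IsLinear f → f u ≈ 0# → f w ≈ 0# → SpanInKernel f u w
  span-⊆-kernel {f} {u} {w} f-lin fu≈0 fw≈0 (s , t , v≈) = begin
    f _                ≈⟨ f-lin s t v≈ ⟩
    s * f u + t * f w  ≈⟨ +-cong (*-congˡ fu≈0) (*-congˡ fw≈0) ⟩
    s * 0# + t * 0#    ≈⟨ +-cong (zeroʳ s) (zeroʳ t) ⟩
    0# + 0#            ≈⟨ +-identityˡ 0# ⟩
    0#                 ∎

  second-coefficient-≉0 : ∀ {x y s t} {u w v : Vec} → ¬ x ≈ 0# → s * x + t * y ≈ 0# →
    (∀ i → v i ≈ s * u i + t * w i) → ¬ IsZero v → ¬ t ≈ 0#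
  second-coefficient-≉0 {x} {y} {s} {t} {u} {w} {v} x≉0 e v≈ v≉0 t≈0 = v≉0 λ i → begin
    v i                ≈⟨ v≈ i ⟩
    s * u i + t * w i  ≈⟨ +-cong (*-congʳ s≈0) (*-congʳ t≈0) ⟩
    0# * u i + 0# * w i ≈⟨ +-cong (zeroˡ (u i)) (zeroˡ (w i)) ⟩
    0# + 0#            ≈⟨ +-identityˡ 0# ⟩
    0#                 ∎
    where
    s≈0 : s ≈ 0#
    s≈0 = x*y≈0⇒y≈0 x≉0 (begin
      x * s            ≈⟨ *-comm x s ⟩
      s * x            ≈⟨ +-identityʳ (s * x) ⟨
      s * x + 0#       ≈⟨ +-congˡ (trans (*-congʳ t≈0) (zeroˡ y)) ⟨
      s * x + t * y    ≈⟨ e ⟩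
      0#               ∎)

  combination-scale : ∀ {u w v v′ : Vec} {s t s′ t′ k} →
    (∀ i → v i ≈ s * u i + t * w i) → (∀ i → v′ i ≈ s′ * u i + t′ * w i) →
    s′ ≈ k * s → t′ ≈ k * t → ∀ i → v′ i ≈ k * v i
  combination-scale {u} {w} {v} {v′} {s} {t} {s′} {t′} {k} v≈ v′≈ s′≈ t′≈ i = begin
    v′ i                          ≈⟨ v′≈ i ⟩
    s′ * u i + t′ * w i           ≈⟨ +-cong (*-congʳ s′≈) (*-congʳ t′≈) ⟩
    k * s * u i + k * t * w i     ≈⟨ solve 5 (λ k s u t w → k :* s :* u :+ k :* t :* w := k :* (s :* u :+ t :* w)) refl k s (u i) t (w i) ⟩
    k * (s * u i + t * w i)       ≈⟨ *-congˡ (v≈ i) ⟨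
    k * v i                       ∎

  scale-≉0 : ∀ {v v′ : Vec} {k} → ¬ IsZero v′ → (∀ i → v′ i ≈ k * v i) → ¬ k ≈ 0#
  scale-≉0 v′≉0 v′≈kv k≈0 = v′≉0 λ i → trans (v′≈kv i) (trans (*-congʳ k≈0) (zeroˡ _))

  span-meets-kernel-onceˡ : ∀ {f u w} → IsLinear f → ¬ f u ≈ 0# → SpanMeetsKernelOnce f u w
  span-meets-kernel-onceˡ {f} {u} {w} f-lin fu≉0 {v} {v′}
    (s , t , v≈) (s′ , t′ , v′≈) v≉0 v′≉0 fv≈0 fv′≈0 =
    k , scale-≉0 v′≉0 v′≈kv , v′≈kv
    where
    e : s * f u + t * f w ≈ 0#
    e = trans (sym (f-lin s t v≈)) fv≈0
    e′ : s′ * f u + t′ * f w ≈ 0#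
    e′ = trans (sym (f-lin s′ t′ v′≈)) fv′≈0
    ratio : Σ Carrier λ k → s′ ≈ k * s × t′ ≈ k * t
    ratio = coefficients-proportional
      (second-coefficient-≉0 fu≉0 e v≈ v≉0) (cross-multiplication fu≉0 e e′)
    k : Carrier
    k = proj₁ ratio
    v′≈kv : ∀ i → v′ i ≈ k * v i
    v′≈kv = combination-scale v≈ v′≈ (proj₁ (proj₂ ratio)) (proj₂ (proj₂ ratio))

  span-meets-kernel-once : ∀ {f u w} → IsLinear f → ¬ f u ≈ 0# ⊎ ¬ f w ≈ 0# →
    SpanMeetsKernelOnce f u w
  span-meets-kernel-once f-lin (inj₁ fu≉0) = span-meets-kernel-onceˡ f-lin fu≉0
  span-meets-kernel-once f-lin (inj₂ fw≉0) v∈ v′∈ =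
    span-meets-kernel-onceˡ f-lin fw≉0 (InSpan-swap v∈) (InSpan-swap v′∈)

  span-dichotomy : ∀ {f u w} → IsLinear f →
    ¬ ¬ (SpanInKernel f u w ⊎ SpanMeetsKernelOnce f u w)
  span-dichotomy {f} {u} {w} f-lin ¬dichotomy =
    ¬¬-excluded-middle λ fu≈0? → ¬¬-excluded-middle λ fw≈0? → ¬dichotomy (classify fu≈0? fw≈0?)
    where
    classify : Dec (f u ≈ 0#) → Dec (f w ≈ 0#) →
      SpanInKernel f u w ⊎ SpanMeetsKernelOnce f u w
    classify (yes fu≈0) (yes fw≈0) = inj₁ (span-⊆-kernel f-lin fu≈0 fw≈0)
    classify (no fu≉0)  _          = inj₂ (span-meets-kernel-once f-lin (inj₁ fu≉0))
    classify _          (no fw≉0)  = inj₂ (span-meets-kernel-once f-lin (inj₂ fw≉0))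

  module _ {ℓ′} (C : AntiFlag → Set ℓ′) where

    AllOn : ∀ {p} → (AntiFlag → Set p) → Set (c ⊔ ℓ ⊔ ℓ′ ⊔ p)
    AllOn β = ∀ {b} → C b → β b

    SubsingletonOn : ∀ {p} → (AntiFlag → Set p) → Set (c ⊔ ℓ ⊔ ℓ′ ⊔ p)
    SubsingletonOn β = ∀ {b b′} → C b → C b′ → β b → β b′ → b ≋ b′

    FourAlternatives : AntiFlag → Set (c ⊔ ℓ ⊔ ℓ′)
    FourAlternatives A = Empty∩ A C ⊎ Singleton∩ A C ⊎ AllButOne∩ A C ⊎ All∩ A C

    pencil-dichotomy : ∀ {f u w} → IsLinear f → (sel : AntiFlag → Vec) →
      (∀ b → ¬ IsZero (sel b)) → (∀ {b} → C b → InSpan u w (sel b)) →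
      (∀ {b b′} → C b → C b′ → Proportional (sel b) (sel b′) → b ≋ b′) →
      ¬ ¬ (AllOn (λ b → f (sel b) ≈ 0#) ⊎ SubsingletonOn (λ b → f (sel b) ≈ 0#))
    pencil-dichotomy {f} {u} {w} f-lin sel sel≉0 sel∈span sel-injective =
      ¬¬-map (Sum.map restrict-in-kernel restrict-meets-once) (span-dichotomy f-lin)
      where
      restrict-in-kernel : SpanInKernel f u w → AllOn (λ b → f (sel b) ≈ 0#)
      restrict-in-kernel span⊆kernel Cb = span⊆kernel (sel∈span Cb)
      restrict-meets-once : SpanMeetsKernelOnce f u w → SubsingletonOn (λ b → f (sel b) ≈ 0#)
      restrict-meets-once meets-once {b} {b′} Cb Cb′ βb βb′ = sel-injective Cb Cb′
        (meets-once (sel∈span Cb) (sel∈span Cb′) (sel≉0 b) (sel≉0 b′) βb βb′)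

    four-alternatives : ∀ {p q} {X : Set p} {β : AntiFlag → Set q} {A} →
      (∀ {b} → C b → A ∼₁ b ⇔ Xor X (β b)) → ¬ ¬ (AllOn β ⊎ SubsingletonOn β) →
      ¬ ¬ FourAlternatives A
    four-alternatives {X = X} {β} {A} neighbour dichotomy ¬alternatives =
      ¬¬-excluded-middle λ X? → dichotomy λ shape → ¬¬-excluded-middle λ ∃β? →
      ¬alternatives (classify X? shape ∃β?)
      where
      classify : Dec X → AllOn β ⊎ SubsingletonOn β → Dec (∃ λ b → C b × β b) →
        FourAlternatives A
      classify (yes x) (inj₁ all) _ =
        inj₁ λ b Cb A∼b → Xor-trueˡ x (to (neighbour Cb) A∼b) (all Cb)
      classify (yes x) (inj₂ sub) (yes (b , Cb , βb)) =
        inj₂ (inj₂ (inj₁ (b , (Cb , λ A∼b → Xor-trueˡ x (to (neighbour Cb) A∼b) βb) ,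
          λ b′ Cb′ b′≉b → from (neighbour Cb′) (inj₁ (x , λ βb′ → b′≉b (sub Cb′ Cb βb′ βb))))))
      classify (yes x) (inj₂ sub) (no ∄β) =
        inj₂ (inj₂ (inj₂ λ b Cb → from (neighbour Cb) (inj₁ (x , λ βb → ∄β (b , Cb , βb)))))
      classify (no ¬x) (inj₁ all) _ =
        inj₂ (inj₂ (inj₂ λ b Cb → from (neighbour Cb) (inj₂ (all Cb , ¬x))))
      classify (no ¬x) (inj₂ sub) (yes (b , Cb , βb)) =
        inj₂ (inj₁ (b , (Cb , from (neighbour Cb) (inj₂ (βb , ¬x))) ,
          λ b′ Cb′ A∼b′ → sub Cb′ Cb (Xor-falseˡ ¬x (to (neighbour Cb′) A∼b′)) βb))
      classify (no ¬x) (inj₂ sub) (no ∄β) =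
        inj₁ λ b Cb A∼b → ∄β (b , Cb , Xor-falseˡ ¬x (to (neighbour Cb) A∼b))

    module _ (C-wd : WellDefined C) {A : AntiFlag} (A∉C : ¬ C A) where

      ∼₁⇔Xor : ∀ {b} → C b → A ∼₁ b ⇔ Xor (pt A ∈ₕ hyp b) (pt b ∈ₕ hyp A)
      ∼₁⇔Xor {b} Cb = mk⇔ proj₂ (A≉b ,_)
        where
        A≉b : ¬ A ≋ b
        A≉b A≋b = A∉C (C-wd b A (≋-sym {A} {b} A≋b) Cb)

      linear-alternatives : Linear C → ¬ ¬ FourAlternatives A
      linear-alternatives (H₀ , _ , u , w , _ , on-line) =
        four-alternatives {A = A} neighbour
          (pencil-dichotomy (⟨⟩-linearʳ (hyp A)) pt pt≠0 (proj₂ ∘ on-line _) same-pt)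
        where
        neighbour : ∀ {b} → C b → A ∼₁ b ⇔ Xor (pt A ∈ₕ H₀) (pt b ∈ₕ hyp A)
        neighbour Cb = Xor-congˡ (⇔-sym (∝-preserves-kernel (⟨⟩-linearˡ (pt A)) (proj₁ (on-line _ Cb))))
          ⇔-∘ ∼₁⇔Xor Cb
        same-pt : ∀ {b b′} → C b → C b′ → Proportional (pt b) (pt b′) → b ≋ b′
        same-pt Cb Cb′ pb∝pb′ = pb∝pb′ , ∝-trans (∝-sym (proj₁ (on-line _ Cb))) (proj₁ (on-line _ Cb′))

      dually-linear-alternatives : DuallyLinear C → ¬ ¬ FourAlternatives A
      dually-linear-alternatives (p₀ , _ , φ , ψ , _ , on-line) =
        four-alternatives {A = A} neighbour
          (pencil-dichotomy (⟨⟩-linearˡ (pt A)) hyp hyp≠0 (proj₂ ∘ on-line _) same-hyp)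
        where
        neighbour : ∀ {b} → C b → A ∼₁ b ⇔ Xor (p₀ ∈ₕ hyp A) (pt A ∈ₕ hyp b)
        neighbour Cb = Xor-congˡ (⇔-sym (∝-preserves-kernel (⟨⟩-linearʳ (hyp A)) (proj₁ (on-line _ Cb))))
          ⇔-∘ (Xor-comm ⇔-∘ ∼₁⇔Xor Cb)
        same-hyp : ∀ {b b′} → C b → C b′ → Proportional (hyp b) (hyp b′) → b ≋ b′
        same-hyp Cb Cb′ Hb∝Hb′ = ∝-trans (∝-sym (proj₁ (on-line _ Cb))) (proj₁ (on-line _ Cb′)) , Hb∝Hb′

open ProjectiveProperties using (linear-alternatives; dually-linear-alternatives)

lemma3 : ∀ {c ℓ ℓ'} (F : Field c ℓ) (n : ℕ) → 3 ≤ n →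
    let open Projective F n in
    (C : AntiFlag → Set ℓ') → WellDefined C → Coclique C →
    (Linear C ⊎ DuallyLinear C) →
    (A : AntiFlag) → ¬ C A →
    ¬ ¬ (Empty∩ A C ⊎ Singleton∩ A C ⊎ AllButOne∩ A C ⊎ All∩ A C)
lemma3 F n _ C C-wd _ (inj₁ linear) A A∉C = linear-alternatives F n C C-wd A∉C linear
lemma3 F n _ C C-wd _ (inj₂ dually-linear) A A∉C = dually-linear-alternatives F n C C-wd A∉C dually-linear
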